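{- Let $\varphi\in\mathcal{L}^s(\Theta;\tau)$ (for some $s\in\{\pm,+,-\}$), let $\rho$ be a valuation of $\Theta$ and $i$ an iteration variable. If $i\ \mathrm{Pos}\ \varphi$, then $n\leq m$ implies $[\![\varphi]\!]\rho[n/i]\subseteq[\![\varphi]\!]\rho[m/i]$. If $i\ \mathrm{Neg}\ \varphi$, then $m\leq n$ implies $[\![\varphi]\!]\rho[n/i]\subseteq[\![\varphi]\!]\rho[m/i]$ (i.e. $n\mapsto[\![\varphi]\!]\rho[n/i]$ is antimonotone).
   Context: Pure types: closed types generated by $\tau ::= 1 \mid \tau\times\tau \mid \tau\to\tau \mid \tau+\tau \mid X \mid \mu X.\tau$. Interpretation in Scott domains: $[\![1]\!]=\{\bot<\top\}$; products componentwise with projections $\pi_1,\pi_2$; $[\![\sigma\to\tau]\!]$ = Scott-continuous functions, pointwise order; $[\![\sigma_1+\sigma_2]\!]$ = disjoint union with new bottom, injections $\mathrm{in}_1,\mathrm{in}_2$; $[\![\mu X.\tau]\!]$ = canonical bilimit solution with inverse isomorphisms $\mathrm{fold}:[\![\tau[\mu X.\tau/X]]\!]\to[\![\mu X.\tau]\!]$ and $\mathrm{unfold}$. Formulae. Iteration terms: $t ::= i \mid 0 \mid t+1$. A fixpoint context $\Theta$ is a list of distinct fixpoint variables with pure types. For $s\in\{\pm,+,-\}$ the sets $\mathcal{L}^s(\Theta;\tau)$ are generated simultaneously by: $\top,\bot$, closure under $\wedge,\vee$; $\langle\langle\rangle\rangle\in\mathcal{L}^s(\Theta;1)$; $\varphi\in\mathcal{L}^s(\Theta;\tau_i)$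 gives $\langle\pi_i\rangle\varphi\in\mathcal{L}^s(\Theta;\tau_1\times\tau_2)$ and $\langle\mathrm{in}_i\rangle\varphi\in\mathcal{L}^s(\Theta;\tau_1+\tau_2)$; $\varphi\in\mathcal{L}^s(\Theta;\tau[\mu X.\tau/X])$ gives $\langle\mathrm{fold}\rangle\varphi\in\mathcal{L}^s(\Theta;\mu X.\tau)$; $\alpha\in\mathcal{L}^s(\Theta;\tau)$ if $(\alpha:\tau)\in\Theta$; weakening in $\Theta$; $\varphi\in\mathcal{L}^s(\Theta,\alpha:\tau;\tau)$ gives $(\mu^t\alpha)\varphi,(\nu^t\alpha)\varphi\in\mathcal{L}^s(\Theta;\tau)$; $\varphi\in\mathcal{L}^+(\Theta;\tau)$ with $i\ \mathrm{Pos}\ \varphi$ gives $(\exists i)\varphi\in\mathcal{L}^+(\Theta;\tau)$; $\varphi\in\mathcal{L}^-(\Theta;\tau)$ with $i\ \mathrm{Neg}\ \varphi$ gives $(\forall i)\varphi\in\mathcal{L}^-(\Theta;\tau)$; $\psi\in\mathcal{L}^{ -s}(;\sigma)$, $\varphi\in\mathcal{L}^s(;\tau)$ give $\psi\Rightarrow\varphi\in\mathcal{L}^s(;\sigma\to\tau)$, where $-\pm=\pm$, $-+=-$, $--=+$. $FV$ = free iteration variables ($\exists i,\forall i$ bind $i$). $\mathrm{Pos},\mathrm{Neg}$ are the least relations with: $i\notin FV(\varphi)$ gives both $i\ \mathrm{Pos}\ \varphi$ and $i\ \mathrm{Neg}\ \varphi$; both preserved by $\wedge$, $\vee$ and by $\langle\pi_i\rangle,\langle\mathrm{in}_i\rangle,\langle\mathrm{fold}\rangle$;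 $i\ \mathrm{Neg}\ \psi$, $i\ \mathrm{Pos}\ \varphi$ give $i\ \mathrm{Pos}\ (\psi\Rightarrow\varphi)$; $i\ \mathrm{Pos}\ \psi$, $i\ \mathrm{Neg}\ \varphi$ give $i\ \mathrm{Neg}\ (\psi\Rightarrow\varphi)$; $i\ \mathrm{Pos}\ \varphi$ gives $i\ \mathrm{Pos}\ (\exists j)\varphi$ and $i\ \mathrm{Pos}\ (\mu^t\alpha)\varphi$; $i\ \mathrm{Pos}\ \varphi$ and $i\notin FV(t)$ give $i\ \mathrm{Pos}\ (\nu^t\alpha)\varphi$; $i\ \mathrm{Neg}\ \varphi$ gives $i\ \mathrm{Neg}\ (\forall j)\varphi$ and $i\ \mathrm{Neg}\ (\nu^t\alpha)\varphi$; $i\ \mathrm{Neg}\ \varphi$ and $i\notin FV(t)$ give $i\ \mathrm{Neg}\ (\mu^t\alpha)\varphi$. Semantics. A valuation $\rho$ of $\Theta$ maps each $(\alpha:\sigma)\in\Theta$ to a subset of $[\![\sigma]\!]$ and each iteration variable to a natural number ($[\![t]\!]\rho\in\mathbb{N}$ accordingly). $[\![\varphi]\!]\rho\subseteq[\![\tau]\!]$: $\top\mapsto[\![\tau]\!]$, $\bot\mapsto\emptyset$, $\wedge\mapsto\cap$, $\vee\mapsto\cup$, $\alpha\mapsto\rho(\alpha)$, $\langle\langle\rangle\rangle\mapsto\{\top\}$, $\langle\pi_i\rangle\varphi\mapsto\{x\mid\pi_i(x)\in[\![\varphi]\!]\rho\}$, $\langle\mathrm{in}_i\rangle\varphi\mapsto\{\mathrm{in}_i(x)\mid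 x\in[\![\varphi]\!]\rho\}$, $\langle\mathrm{fold}\rangle\varphi\mapsto\{x\mid\mathrm{unfold}(x)\in[\![\varphi]\!]\rho\}$, $\psi\Rightarrow\varphi\mapsto\{f\mid\forall x\in[\![\psi]\!]\rho,\ f(x)\in[\![\varphi]\!]\rho\}$, $(\exists i)\varphi\mapsto\bigcup_n[\![\varphi]\!]\rho[n/i]$, $(\forall i)\varphi\mapsto\bigcap_n[\![\varphi]\!]\rho[n/i]$, $(\mu^t\alpha)\varphi\mapsto F^{[\![t]\!]\rho}(\emptyset)$, $(\nu^t\alpha)\varphi\mapsto F^{[\![t]\!]\rho}([\![\tau]\!])$ with $F(S)=[\![\varphi]\!]\rho[S/\alpha]$. -}

module Defs where

open import Data.Nat using (ℕ; zero; suc; _≡ᵇ_)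
open import Data.Fin using (Fin; zero; suc)
open import Data.Bool using (if_then_else_)
open import Data.List using (List; []; _∷_)
open import Data.List.Membership.Propositional using (_∈_)
open import Data.List.Relation.Unary.Any using (here; there)
open import Data.Product using (Σ; ∃; _×_; _,_)
open import Relation.Binary.PropositionalEquality using (_≡_; refl)
open import Relation.Nullary using (¬_)
open import Relation.Unary using (Pred; ∅; U; _∩_; _∪_)
open import Level using (0ℓ)

-- Pure types (de Bruijn type variables; closed types are Ty 0)

data Ty (n : ℕ) : Set where
  𝟙   : Ty n
  _⊗_ : Ty n → Ty n → Ty n
  _⇒_ : Ty n → Ty n → Ty n
  _⊕_ : Ty n → Ty n → Ty n
  var : Fin n → Ty n
  μ   : Ty (suc n) → Ty n

ext : ∀ {m n} → (Fin m → Fin n) → Fin (suc m) → Fin (suc n)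
ext r zero    = zero
ext r (suc x) = suc (r x)

ren : ∀ {m n} → (Fin m → Fin n) → Ty m → Ty n
ren r 𝟙       = 𝟙
ren r (a ⊗ b) = ren r a ⊗ ren r b
ren r (a ⇒ b) = ren r a ⇒ ren r b
ren r (a ⊕ b) = ren r a ⊕ ren r b
ren r (var x) = var (r x)
ren r (μ a)   = μ (ren (ext r) a)

exts : ∀ {m n} → (Fin m → Ty n) → Fin (suc m) → Ty (suc n)
exts σ zero    = var zero
exts σ (suc x) = ren suc (σ x)

sub : ∀ {m n} → (Fin m → Ty n) → Ty m → Ty n
sub σ 𝟙       = 𝟙
sub σ (a ⊗ b) = sub σ a ⊗ sub σ b
sub σ (a ⇒ b) = sub σ a ⇒ sub σ b
sub σ (a ⊕ b) = sub σ a ⊕ sub σ b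
sub σ (var x) = σ x
sub σ (μ a)   = μ (sub (exts σ) a)

unfoldTy : Ty 1 → Ty 0
unfoldTy τ = sub (λ _ → μ τ) τ

CTy : Set
CTy = Ty 0

data ITerm : Set where
  ivar : ℕ → ITerm
  izero : ITerm
  isuc : ITerm → ITerm

-- Formulae.  Fixpoint contexts Θ are lists of closed types, fixpoint
-- variables are de Bruijn membership proofs.  The sign index s is
-- handled by the well-formedness predicate WF below.

Ctx : Set
Ctx = List CTy

data Form (Θ : Ctx) : CTy → Set where
  tt ff : ∀ {τ} → Form Θ τ
  _∧_ _∨_ : ∀ {τ} → Form Θ τ → Form Θ τ → Form Θ τ
  ⟨⟨⟩⟩ : Form Θ 𝟙
  ⟨π₁⟩ : ∀ {σ τ} → Form Θ σ → Form Θ (σ ⊗ τ)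
  ⟨π₂⟩ : ∀ {σ τ} → Form Θ τ → Form Θ (σ ⊗ τ)
  ⟨in₁⟩ : ∀ {σ τ} → Form Θ σ → Form Θ (σ ⊕ τ)
  ⟨in₂⟩ : ∀ {σ τ} → Form Θ τ → Form Θ (σ ⊕ τ)
  ⟨fold⟩ : ∀ {τ} → Form Θ (unfoldTy τ) → Form Θ (μ τ)
  fvar : ∀ {τ} → τ ∈ Θ → Form Θ τ
  μ[_] ν[_] : ∀ {τ} → ITerm → Form (τ ∷ Θ) τ → Form Θ τ
  ∃[_] ∀[_] : ∀ {τ} → ℕ → Form Θ τ → Form Θ τ
  _⟹_ : ∀ {σ τ} → Form [] σ → Form [] τ → Form Θ (σ ⇒ τ)

data OccT (i : ℕ) : ITerm → Set where
  here : OccT i (ivar i)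
  suc  : ∀ {t} → OccT i t → OccT i (isuc t)

data Occ (i : ℕ) {Θ : Ctx} : ∀ {τ} → Form Θ τ → Set where
  ∧ˡ : ∀ {τ} {φ ψ : Form Θ τ} → Occ i φ → Occ i (φ ∧ ψ)
  ∧ʳ : ∀ {τ} {φ ψ : Form Θ τ} → Occ i ψ → Occ i (φ ∧ ψ)
  ∨ˡ : ∀ {τ} {φ ψ : Form Θ τ} → Occ i φ → Occ i (φ ∨ ψ)
  ∨ʳ : ∀ {τ} {φ ψ : Form Θ τ} → Occ i ψ → Occ i (φ ∨ ψ)
  oπ₁ : ∀ {σ τ} {φ : Form Θ σ} → Occ i φ → Occ i (⟨π₁⟩ {τ = τ} φ)
  oπ₂ : ∀ {σ τ} {φ : Form Θ τ} → Occ i φ → Occ i (⟨π₂⟩ {σ = σ} φ)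
  oin₁ : ∀ {σ τ} {φ : Form Θ σ} → Occ i φ → Occ i (⟨in₁⟩ {τ = τ} φ)
  oin₂ : ∀ {σ τ} {φ : Form Θ τ} → Occ i φ → Occ i (⟨in₂⟩ {σ = σ} φ)
  ofold : ∀ {τ} {φ : Form Θ (unfoldTy τ)} → Occ i φ → Occ i (⟨fold⟩ {τ = τ} φ)
  μt : ∀ {τ t} {φ : Form (τ ∷ Θ) τ} → OccT i t → Occ i (μ[ t ] φ)
  μb : ∀ {τ t} {φ : Form (τ ∷ Θ) τ} → Occ i φ → Occ i (μ[ t ] φ)
  νt : ∀ {τ t} {φ : Form (τ ∷ Θ) τ} → OccT i t → Occ i (ν[ t ] φ)
  νb : ∀ {τ t} {φ : Form (τ ∷ Θ) τ} → Occ i φ → Occ i (ν[ t ] φ)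
  ∃b : ∀ {τ j} {φ : Form Θ τ} → ¬ (i ≡ j) → Occ i φ → Occ i (∃[ j ] φ)
  ∀b : ∀ {τ j} {φ : Form Θ τ} → ¬ (i ≡ j) → Occ i φ → Occ i (∀[ j ] φ)
  ⟹ˡ : ∀ {σ τ} {ψ : Form [] σ} {φ : Form [] τ} → Occ i ψ → Occ i (_⟹_ {Θ = Θ} ψ φ)
  ⟹ʳ : ∀ {σ τ} {ψ : Form [] σ} {φ : Form [] τ} → Occ i φ → Occ i (_⟹_ {Θ = Θ} ψ φ)

data Pos (i : ℕ) {Θ : Ctx} : ∀ {τ} → Form Θ τ → Set
data Neg (i : ℕ) {Θ : Ctx} : ∀ {τ} → Form Θ τ → Set

data Pos i {Θ} where
  nfv : ∀ {τ} {φ : Form Θ τ} → ¬ Occ i φ → Pos i φ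
  ∧p : ∀ {τ} {φ ψ : Form Θ τ} → Pos i φ → Pos i ψ → Pos i (φ ∧ ψ)
  ∨p : ∀ {τ} {φ ψ : Form Θ τ} → Pos i φ → Pos i ψ → Pos i (φ ∨ ψ)
  π₁p : ∀ {σ τ} {φ : Form Θ σ} → Pos i φ → Pos i (⟨π₁⟩ {τ = τ} φ)
  π₂p : ∀ {σ τ} {φ : Form Θ τ} → Pos i φ → Pos i (⟨π₂⟩ {σ = σ} φ)
  in₁p : ∀ {σ τ} {φ : Form Θ σ} → Pos i φ → Pos i (⟨in₁⟩ {τ = τ} φ)
  in₂p : ∀ {σ τ} {φ : Form Θ τ} → Pos i φ → Pos i (⟨in₂⟩ {σ = σ} φ)
  foldp : ∀ {τ} {φ : Form Θ (unfoldTy τ)} → Pos i φ → Pos i (⟨fold⟩ {τ = τ} φ)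
  ⟹p : ∀ {σ τ} {ψ : Form [] σ} {φ : Form [] τ} → Neg i ψ → Pos i φ → Pos i (_⟹_ {Θ = Θ} ψ φ)
  ∃p : ∀ {τ j} {φ : Form Θ τ} → Pos i φ → Pos i (∃[ j ] φ)
  μp : ∀ {τ t} {φ : Form (τ ∷ Θ) τ} → Pos i φ → Pos i (μ[ t ] φ)
  νp : ∀ {τ t} {φ : Form (τ ∷ Θ) τ} → Pos i φ → ¬ OccT i t → Pos i (ν[ t ] φ)

data Neg i {Θ} where
  nfv : ∀ {τ} {φ : Form Θ τ} → ¬ Occ i φ → Neg i φ
  ∧n : ∀ {τ} {φ ψ : Form Θ τ} → Neg i φ → Neg i ψ → Neg i (φ ∧ ψ)
  ∨n : ∀ {τ} {φ ψ : Form Θ τ} → Neg i φ → Neg i ψ → Neg i (φ ∨ ψ)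
  π₁n : ∀ {σ τ} {φ : Form Θ σ} → Neg i φ → Neg i (⟨π₁⟩ {τ = τ} φ)
  π₂n : ∀ {σ τ} {φ : Form Θ τ} → Neg i φ → Neg i (⟨π₂⟩ {σ = σ} φ)
  in₁n : ∀ {σ τ} {φ : Form Θ σ} → Neg i φ → Neg i (⟨in₁⟩ {τ = τ} φ)
  in₂n : ∀ {σ τ} {φ : Form Θ τ} → Neg i φ → Neg i (⟨in₂⟩ {σ = σ} φ)
  foldn : ∀ {τ} {φ : Form Θ (unfoldTy τ)} → Neg i φ → Neg i (⟨fold⟩ {τ = τ} φ)
  ⟹n : ∀ {σ τ} {ψ : Form [] σ} {φ : Form [] τ} → Pos i ψ → Neg i φ → Neg i (_⟹_ {Θ = Θ} ψ φ)
  ∀n : ∀ {τ j} {φ : Form Θ τ} → Neg i φ → Neg i (∀[ j ] φ)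
  νn : ∀ {τ t} {φ : Form (τ ∷ Θ) τ} → Neg i φ → Neg i (ν[ t ] φ)
  μn : ∀ {τ t} {φ : Form (τ ∷ Θ) τ} → Neg i φ → ¬ OccT i t → Neg i (μ[ t ] φ)

-- Signs and the classes L^s(Θ;τ):  φ ∈ L^s(Θ;τ)  iff  WF s φ

data Sign : Set where
  ± ⁺ ⁻ : Sign

negS : Sign → Sign
negS ± = ±
negS ⁺ = ⁻
negS ⁻ = ⁺

data WF {Θ : Ctx} : ∀ {τ} → Sign → Form Θ τ → Set where
  tt : ∀ {s τ} → WF s (tt {τ = τ})
  ff : ∀ {s τ} → WF s (ff {τ = τ})
  _∧_ : ∀ {s τ} {φ ψ : Form Θ τ} → WF s φ → WF s ψ → WF s (φ ∧ ψ)
  _∨_ : ∀ {s τ} {φ ψ : Form Θ τ} → WF s φ → WF s ψ → WF s (φ ∨ ψ)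
  ⟨⟨⟩⟩ : ∀ {s} → WF s ⟨⟨⟩⟩
  ⟨π₁⟩ : ∀ {s σ τ} {φ : Form Θ σ} → WF s φ → WF s (⟨π₁⟩ {τ = τ} φ)
  ⟨π₂⟩ : ∀ {s σ τ} {φ : Form Θ τ} → WF s φ → WF s (⟨π₂⟩ {σ = σ} φ)
  ⟨in₁⟩ : ∀ {s σ τ} {φ : Form Θ σ} → WF s φ → WF s (⟨in₁⟩ {τ = τ} φ)
  ⟨in₂⟩ : ∀ {s σ τ} {φ : Form Θ τ} → WF s φ → WF s (⟨in₂⟩ {σ = σ} φ)
  ⟨fold⟩ : ∀ {s τ} {φ : Form Θ (unfoldTy τ)} → WF s φ → WF s (⟨fold⟩ {τ = τ} φ)
  fvar : ∀ {s τ} (x : τ ∈ Θ) → WF s (fvar x)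
  μ[_] : ∀ {s τ} t {φ : Form (τ ∷ Θ) τ} → WF s φ → WF s (μ[ t ] φ)
  ν[_] : ∀ {s τ} t {φ : Form (τ ∷ Θ) τ} → WF s φ → WF s (ν[ t ] φ)
  ∃[_] : ∀ {τ} i {φ : Form Θ τ} → WF ⁺ φ → Pos i φ → WF ⁺ (∃[ i ] φ)
  ∀[_] : ∀ {τ} i {φ : Form Θ τ} → WF ⁻ φ → Neg i φ → WF ⁻ (∀[ i ] φ)
  _⟹_ : ∀ {s σ τ} {ψ : Form [] σ} {φ : Form [] τ} →
        WF (negS s) ψ → WF s φ → WF s (_⟹_ {Θ = Θ} ψ φ)

record Model : Set₁ where
  field
    D      : CTy → Set
    ⊤₁     : D 𝟙
    π₁     : ∀ {σ τ} → D (σ ⊗ τ) → D σ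
    π₂     : ∀ {σ τ} → D (σ ⊗ τ) → D τ
    in₁    : ∀ {σ τ} → D σ → D (σ ⊕ τ)
    in₂    : ∀ {σ τ} → D τ → D (σ ⊕ τ)
    fold   : ∀ {τ} → D (unfoldTy τ) → D (μ τ)
    unfold : ∀ {τ} → D (μ τ) → D (unfoldTy τ)
    fold∘unfold : ∀ {τ} (x : D (μ τ)) → fold (unfold x) ≡ x
    unfold∘fold : ∀ {τ} (x : D (unfoldTy τ)) → unfold {τ} (fold x) ≡ x
    app    : ∀ {σ τ} → D (σ ⇒ τ) → D σ → D τ

IVal : Set
IVal = ℕ → ℕ

_[_↦_] : IVal → ℕ → ℕ → IVal
(ι [ i ↦ n ]) j = if j ≡ᵇ i then n else ι j

evalT : IVal → ITerm → ℕ
evalT ι (ivar i) = ι i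
evalT ι izero = zero
evalT ι (isuc t) = suc (evalT ι t)

iter : ∀ {A : Set₁} → ℕ → (A → A) → A → A
iter zero F x = x
iter (suc n) F x = F (iter n F x)

module Sem (M : Model) where
  open Model M

  FVal : Ctx → Set₁
  FVal Θ = ∀ {σ} → σ ∈ Θ → Pred (D σ) 0ℓ

  extF : ∀ {Θ τ} → Pred (D τ) 0ℓ → FVal Θ → FVal (τ ∷ Θ)
  extF S ρ (here refl) = S
  extF S ρ (there x) = ρ x

  emptyF : FVal []
  emptyF ()

  ⟦_⟧ : ∀ {Θ τ} → Form Θ τ → IVal → FVal Θ → Pred (D τ) 0ℓ
  ⟦ tt ⟧ ι ρ = U
  ⟦ ff ⟧ ι ρ = ∅
  ⟦ φ ∧ ψ ⟧ ι ρ = ⟦ φ ⟧ ι ρ ∩ ⟦ ψ ⟧ ι ρ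
  ⟦ φ ∨ ψ ⟧ ι ρ = ⟦ φ ⟧ ι ρ ∪ ⟦ ψ ⟧ ι ρ
  ⟦ ⟨⟨⟩⟩ ⟧ ι ρ = λ x → x ≡ ⊤₁
  ⟦ ⟨π₁⟩ φ ⟧ ι ρ = λ x → ⟦ φ ⟧ ι ρ (π₁ x)
  ⟦ ⟨π₂⟩ φ ⟧ ι ρ = λ x → ⟦ φ ⟧ ι ρ (π₂ x)
  ⟦ ⟨in₁⟩ φ ⟧ ι ρ = λ y → ∃ λ x → (y ≡ in₁ x) × ⟦ φ ⟧ ι ρ x
  ⟦ ⟨in₂⟩ φ ⟧ ι ρ = λ y → ∃ λ x → (y ≡ in₂ x) × ⟦ φ ⟧ ι ρ x
  ⟦ ⟨fold⟩ φ ⟧ ι ρ = λ x → ⟦ φ ⟧ ι ρ (unfold x)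
  ⟦ fvar x ⟧ ι ρ = ρ x
  ⟦ μ[ t ] φ ⟧ ι ρ = iter (evalT ι t) (λ S → ⟦ φ ⟧ ι (extF S ρ)) ∅
  ⟦ ν[ t ] φ ⟧ ι ρ = iter (evalT ι t) (λ S → ⟦ φ ⟧ ι (extF S ρ)) U
  ⟦ ∃[ i ] φ ⟧ ι ρ = λ x → ∃ λ n → ⟦ φ ⟧ (ι [ i ↦ n ]) ρ x
  ⟦ ∀[ i ] φ ⟧ ι ρ = λ x → ∀ n → ⟦ φ ⟧ (ι [ i ↦ n ]) ρ x
  ⟦ ψ ⟹ φ ⟧ ι ρ = λ f → ∀ x → ⟦ ψ ⟧ ι emptyF x → ⟦ φ ⟧ ι emptyF (app f x)

module Submission where

open import Defs
open import Data.Bool using (true; false; T)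
open import Data.Nat using (ℕ; suc; _≤_; _≡ᵇ_; z≤n; s≤s)
open import Data.Nat.Properties using (≤-refl; ≤-reflexive; _≟_; ≡ᵇ⇒≡; ≡⇒≡ᵇ)
open import Data.Product using (_×_; _,_)
open import Data.Sum using (inj₁; inj₂)
open import Data.Unit using (tt)
open import Data.Empty using (⊥-elim)
open import Data.List using (_∷_)
open import Data.List.Membership.Propositional using (_∈_)
open import Data.List.Relation.Unary.Any using (here; there)
open import Relation.Nullary using (¬_; yes; no)
open import Relation.Binary.Core using (_Preserves_⟶_)
open import Relation.Binary.PropositionalEquality using (_≡_; _≢_; refl; sym; cong; subst)
open import Relation.Unary using (Pred; _⊆_; ∅; U)
open import Level using (0ℓ)

-- Every formula is monotone in its fixpoint variables, so the approximants
-- F^n(∅) grow and F^n(U) shrink with n.  Hence raising i enlarges a formula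
-- in which i is positive: a μ-bound may grow with i, a ν-bound must not
-- mention i, and the antecedent of ⇒ is negative, so Pos and Neg are proved
-- simultaneously, Neg with the two valuations exchanged.

[↦]-pointwise : (R : ℕ → ℕ → Set) (ι₁ ι₂ : IVal) {j k₁ k₂ l : ℕ} →
                (l ≡ j → R k₁ k₂) → (l ≢ j → R (ι₁ l) (ι₂ l)) →
                R ((ι₁ [ j ↦ k₁ ]) l) ((ι₂ [ j ↦ k₂ ]) l)
[↦]-pointwise R ι₁ ι₂ {j = j} {l = l} same other with l ≡ᵇ j in eq
... | true  = same (≡ᵇ⇒≡ l j (subst T (sym eq) tt))
... | false = other (λ l≡j → subst T eq (≡⇒≡ᵇ l j l≡j))

AgreeOn : (ℕ → Set) → IVal → IVal → Set
AgreeOn P ι₁ ι₂ = ∀ {j} → P j → ι₁ j ≡ ι₂ j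

record _≤[_]_ (ι₁ : IVal) (i : ℕ) (ι₂ : IVal) : Set where
  field
    agree-off : ∀ {j} → j ≢ i → ι₁ j ≡ ι₂ j
    ≤-at      : ι₁ i ≤ ι₂ i
open _≤[_]_

update-≤[] : ∀ ι i {n m} → n ≤ m → (ι [ i ↦ n ]) ≤[ i ] (ι [ i ↦ m ])
update-≤[] ι i n≤m = record
  { agree-off = λ j≢i → [↦]-pointwise _≡_ ι ι (λ j≡i → ⊥-elim (j≢i j≡i)) (λ _ → refl)
  ; ≤-at      = [↦]-pointwise _≤_ ι ι (λ _ → n≤m) (λ i≢i → ⊥-elim (i≢i refl))
  }

≤[]-update : ∀ {ι₁ ι₂ i} j k → ι₁ ≤[ i ] ι₂ → (ι₁ [ j ↦ k ]) ≤[ i ] (ι₂ [ j ↦ k ])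
≤[]-update {ι₁} {ι₂} j k le = record
  { agree-off = λ j≢i → [↦]-pointwise _≡_ ι₁ ι₂ (λ _ → refl) (λ _ → agree-off le j≢i)
  ; ≤-at      = [↦]-pointwise _≤_ ι₁ ι₂ (λ _ → ≤-refl) (λ _ → ≤-at le)
  }

≤[]⇒agreeOn : ∀ {P : ℕ → Set} {ι₁ ι₂ i} → ι₁ ≤[ i ] ι₂ → ¬ P i → AgreeOn P ι₁ ι₂
≤[]⇒agreeOn le ¬Pi {j} Pj = agree-off le (λ { refl → ¬Pi Pj })

evalT-agreeOn : ∀ {ι₁ ι₂} t → AgreeOn (λ j → OccT j t) ι₁ ι₂ → evalT ι₁ t ≡ evalT ι₂ t
evalT-agreeOn (ivar j) agree = agree here
evalT-agreeOn izero    agree = refl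
evalT-agreeOn (isuc t) agree = cong suc (evalT-agreeOn t (λ o → agree (suc o)))

evalT-mono : ∀ {ι₁ ι₂ i} t → ι₁ ≤[ i ] ι₂ → evalT ι₁ t ≤ evalT ι₂ t
evalT-mono {i = i} (ivar j) le with j ≟ i
... | yes refl = ≤-at le
... | no  j≢i  = ≤-reflexive (agree-off le j≢i)
evalT-mono izero    le = z≤n
evalT-mono (isuc t) le = s≤s (evalT-mono t le)

module _ {X : Set} {F G : Pred X 0ℓ → Pred X 0ℓ}
         (G-mono : G Preserves _⊆_ ⟶ _⊆_) (F⊆G : ∀ S → F S ⊆ G S) where

  iter-∅-⊆ : ∀ {n m} → n ≤ m → iter n F ∅ ⊆ iter m G ∅
  iter-∅-⊆ z≤n       ()
  iter-∅-⊆ (s≤s n≤m) x∈ = G-mono (iter-∅-⊆ n≤m) (F⊆G _ x∈)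

  iter-U-⊆ : ∀ {n m} → m ≤ n → iter n F U ⊆ iter m G U
  iter-U-⊆ z≤n       _  = tt
  iter-U-⊆ (s≤s m≤n) x∈ = G-mono (iter-U-⊆ m≤n) (F⊆G _ x∈)

module _ (M : Model) where
  open Model M
  open Sem M

  _⊆ᵛ_ : ∀ {Θ} → FVal Θ → FVal Θ → Set
  ρ₁ ⊆ᵛ ρ₂ = ∀ {σ} (x : σ ∈ _) → ρ₁ x ⊆ ρ₂ x

  extF-⊆ᵛ : ∀ {Θ τ} {ρ₁ ρ₂ : FVal Θ} {S S' : Pred (D τ) 0ℓ} →
            S ⊆ S' → ρ₁ ⊆ᵛ ρ₂ → extF S ρ₁ ⊆ᵛ extF S' ρ₂
  extF-⊆ᵛ S⊆S' ρ₁⊆ρ₂ (here refl) = S⊆S'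
  extF-⊆ᵛ S⊆S' ρ₁⊆ρ₂ (there x)   = ρ₁⊆ρ₂ x

  ⟦⟧-body-mono : ∀ {Θ τ} (φ : Form (τ ∷ Θ) τ) ι {ρ : FVal Θ} →
                 (λ S → ⟦ φ ⟧ ι (extF S ρ)) Preserves _⊆_ ⟶ _⊆_

  ⟦⟧-monoᵛ : ∀ {Θ τ} (φ : Form Θ τ) ι {ρ₁ ρ₂ : FVal Θ} → ρ₁ ⊆ᵛ ρ₂ → ⟦ φ ⟧ ι ρ₁ ⊆ ⟦ φ ⟧ ι ρ₂

  ⟦⟧-body-mono φ ι S⊆S' = ⟦⟧-monoᵛ φ ι (extF-⊆ᵛ S⊆S' (λ x x∈ → x∈))

  ⟦⟧-monoᵛ tt         ι ρ₁⊆ρ₂ x∈ = x∈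
  ⟦⟧-monoᵛ ff         ι ρ₁⊆ρ₂ ()
  ⟦⟧-monoᵛ (φ ∧ ψ)    ι ρ₁⊆ρ₂ (x∈φ , x∈ψ) = ⟦⟧-monoᵛ φ ι ρ₁⊆ρ₂ x∈φ , ⟦⟧-monoᵛ ψ ι ρ₁⊆ρ₂ x∈ψ
  ⟦⟧-monoᵛ (φ ∨ ψ)    ι ρ₁⊆ρ₂ (inj₁ x∈) = inj₁ (⟦⟧-monoᵛ φ ι ρ₁⊆ρ₂ x∈)
  ⟦⟧-monoᵛ (φ ∨ ψ)    ι ρ₁⊆ρ₂ (inj₂ x∈) = inj₂ (⟦⟧-monoᵛ ψ ι ρ₁⊆ρ₂ x∈)
  ⟦⟧-monoᵛ ⟨⟨⟩⟩       ι ρ₁⊆ρ₂ x∈ = x∈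
  ⟦⟧-monoᵛ (⟨π₁⟩ φ)   ι ρ₁⊆ρ₂ x∈ = ⟦⟧-monoᵛ φ ι ρ₁⊆ρ₂ x∈
  ⟦⟧-monoᵛ (⟨π₂⟩ φ)   ι ρ₁⊆ρ₂ x∈ = ⟦⟧-monoᵛ φ ι ρ₁⊆ρ₂ x∈
  ⟦⟧-monoᵛ (⟨in₁⟩ φ)  ι ρ₁⊆ρ₂ (x , eq , x∈) = x , eq , ⟦⟧-monoᵛ φ ι ρ₁⊆ρ₂ x∈
  ⟦⟧-monoᵛ (⟨in₂⟩ φ)  ι ρ₁⊆ρ₂ (x , eq , x∈) = x , eq , ⟦⟧-monoᵛ φ ι ρ₁⊆ρ₂ x∈
  ⟦⟧-monoᵛ (⟨fold⟩ φ) ι ρ₁⊆ρ₂ x∈ = ⟦⟧-monoᵛ φ ι ρ₁⊆ρ₂ x∈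
  ⟦⟧-monoᵛ (fvar x)   ι ρ₁⊆ρ₂ x∈ = ρ₁⊆ρ₂ x x∈
  ⟦⟧-monoᵛ (μ[ t ] φ) ι ρ₁⊆ρ₂ =
    iter-∅-⊆ (⟦⟧-body-mono φ ι) (λ _ → ⟦⟧-monoᵛ φ ι (extF-⊆ᵛ (λ x∈ → x∈) ρ₁⊆ρ₂))
      (≤-refl {evalT ι t})
  ⟦⟧-monoᵛ (ν[ t ] φ) ι ρ₁⊆ρ₂ =
    iter-U-⊆ (⟦⟧-body-mono φ ι) (λ _ → ⟦⟧-monoᵛ φ ι (extF-⊆ᵛ (λ x∈ → x∈) ρ₁⊆ρ₂))
      (≤-refl {evalT ι t})
  ⟦⟧-monoᵛ (∃[ j ] φ) ι ρ₁⊆ρ₂ (k , x∈) = k , ⟦⟧-monoᵛ φ (ι [ j ↦ k ]) ρ₁⊆ρ₂ x∈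
  ⟦⟧-monoᵛ (∀[ j ] φ) ι ρ₁⊆ρ₂ x∈ k = ⟦⟧-monoᵛ φ (ι [ j ↦ k ]) ρ₁⊆ρ₂ (x∈ k)
  ⟦⟧-monoᵛ (ψ ⟹ φ)    ι ρ₁⊆ρ₂ f∈ = f∈

  ⟦⟧-agreeOn : ∀ {Θ τ} (φ : Form Θ τ) {ι₁ ι₂} {ρ : FVal Θ} →
               AgreeOn (λ j → Occ j φ) ι₁ ι₂ → ⟦ φ ⟧ ι₁ ρ ⊆ ⟦ φ ⟧ ι₂ ρ
  ⟦⟧-agreeOn tt         agree x∈ = x∈
  ⟦⟧-agreeOn ff         agree ()
  ⟦⟧-agreeOn (φ ∧ ψ)    agree (x∈φ , x∈ψ) =
    ⟦⟧-agreeOn φ (λ o → agree (∧ˡ o)) x∈φ , ⟦⟧-agreeOn ψ (λ o → agree (∧ʳ o)) x∈ψ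
  ⟦⟧-agreeOn (φ ∨ ψ)    agree (inj₁ x∈) = inj₁ (⟦⟧-agreeOn φ (λ o → agree (∨ˡ o)) x∈)
  ⟦⟧-agreeOn (φ ∨ ψ)    agree (inj₂ x∈) = inj₂ (⟦⟧-agreeOn ψ (λ o → agree (∨ʳ o)) x∈)
  ⟦⟧-agreeOn ⟨⟨⟩⟩       agree x∈ = x∈
  ⟦⟧-agreeOn (⟨π₁⟩ φ)   agree x∈ = ⟦⟧-agreeOn φ (λ o → agree (oπ₁ o)) x∈
  ⟦⟧-agreeOn (⟨π₂⟩ φ)   agree x∈ = ⟦⟧-agreeOn φ (λ o → agree (oπ₂ o)) x∈
  ⟦⟧-agreeOn (⟨in₁⟩ φ)  agree (x , eq , x∈) = x , eq , ⟦⟧-agreeOn φ (λ o → agree (oin₁ o)) x∈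
  ⟦⟧-agreeOn (⟨in₂⟩ φ)  agree (x , eq , x∈) = x , eq , ⟦⟧-agreeOn φ (λ o → agree (oin₂ o)) x∈
  ⟦⟧-agreeOn (⟨fold⟩ φ) agree x∈ = ⟦⟧-agreeOn φ (λ o → agree (ofold o)) x∈
  ⟦⟧-agreeOn (fvar x)   agree x∈ = x∈
  ⟦⟧-agreeOn (μ[ t ] φ) {ι₂ = ι₂} agree =
    iter-∅-⊆ (⟦⟧-body-mono φ ι₂) (λ _ → ⟦⟧-agreeOn φ (λ o → agree (μb o)))
      (≤-reflexive (evalT-agreeOn t (λ o → agree (μt o))))
  ⟦⟧-agreeOn (ν[ t ] φ) {ι₂ = ι₂} agree =
    iter-U-⊆ (⟦⟧-body-mono φ ι₂) (λ _ → ⟦⟧-agreeOn φ (λ o → agree (νb o)))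
      (≤-reflexive (evalT-agreeOn t (λ o → sym (agree (νt o)))))
  ⟦⟧-agreeOn (∃[ j ] φ) {ι₁} {ι₂} agree (k , x∈) =
    k , ⟦⟧-agreeOn φ (λ o → [↦]-pointwise _≡_ ι₁ ι₂ (λ _ → refl) (λ l≢j → agree (∃b l≢j o))) x∈
  ⟦⟧-agreeOn (∀[ j ] φ) {ι₁} {ι₂} agree x∈ k =
    ⟦⟧-agreeOn φ (λ o → [↦]-pointwise _≡_ ι₁ ι₂ (λ _ → refl) (λ l≢j → agree (∀b l≢j o))) (x∈ k)
  ⟦⟧-agreeOn (ψ ⟹ φ)    agree f∈ x x∈ψ =
    ⟦⟧-agreeOn φ (λ o → agree (⟹ʳ o)) (f∈ x (⟦⟧-agreeOn ψ (λ o → sym (agree (⟹ˡ o))) x∈ψ))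

  ⟦⟧-pos-mono : ∀ {Θ τ} {φ : Form Θ τ} {i ι₁ ι₂} {ρ : FVal Θ} →
                Pos i φ → ι₁ ≤[ i ] ι₂ → ⟦ φ ⟧ ι₁ ρ ⊆ ⟦ φ ⟧ ι₂ ρ
  ⟦⟧-neg-antimono : ∀ {Θ τ} {φ : Form Θ τ} {i ι₁ ι₂} {ρ : FVal Θ} →
                    Neg i φ → ι₂ ≤[ i ] ι₁ → ⟦ φ ⟧ ι₁ ρ ⊆ ⟦ φ ⟧ ι₂ ρ

  ⟦⟧-pos-mono {φ = φ} (nfv ¬occ) le = ⟦⟧-agreeOn φ (≤[]⇒agreeOn le ¬occ)
  ⟦⟧-pos-mono (∧p pos₁ pos₂) le (x∈₁ , x∈₂) = ⟦⟧-pos-mono pos₁ le x∈₁ , ⟦⟧-pos-mono pos₂ le x∈₂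
  ⟦⟧-pos-mono (∨p pos₁ pos₂) le (inj₁ x∈) = inj₁ (⟦⟧-pos-mono pos₁ le x∈)
  ⟦⟧-pos-mono (∨p pos₁ pos₂) le (inj₂ x∈) = inj₂ (⟦⟧-pos-mono pos₂ le x∈)
  ⟦⟧-pos-mono (π₁p pos) le x∈ = ⟦⟧-pos-mono pos le x∈
  ⟦⟧-pos-mono (π₂p pos) le x∈ = ⟦⟧-pos-mono pos le x∈
  ⟦⟧-pos-mono (in₁p pos) le (x , eq , x∈) = x , eq , ⟦⟧-pos-mono pos le x∈
  ⟦⟧-pos-mono (in₂p pos) le (x , eq , x∈) = x , eq , ⟦⟧-pos-mono pos le x∈
  ⟦⟧-pos-mono (foldp pos) le x∈ = ⟦⟧-pos-mono pos le x∈
  ⟦⟧-pos-mono (⟹p neg pos) le f∈ x x∈ψ = ⟦⟧-pos-mono pos le (f∈ x (⟦⟧-neg-antimono neg le x∈ψ))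
  ⟦⟧-pos-mono (∃p {j = j} pos) le (k , x∈) = k , ⟦⟧-pos-mono pos (≤[]-update j k le) x∈
  ⟦⟧-pos-mono {ι₂ = ι₂} (μp {t = t} {φ} pos) le =
    iter-∅-⊆ (⟦⟧-body-mono φ ι₂) (λ _ → ⟦⟧-pos-mono pos le) (evalT-mono t le)
  ⟦⟧-pos-mono {ι₂ = ι₂} (νp {t = t} {φ} pos ¬occ) le =
    iter-U-⊆ (⟦⟧-body-mono φ ι₂) (λ _ → ⟦⟧-pos-mono pos le)
      (≤-reflexive (sym (evalT-agreeOn t (≤[]⇒agreeOn le ¬occ))))

  ⟦⟧-neg-antimono {φ = φ} (nfv ¬occ) le = ⟦⟧-agreeOn φ (λ {j} o → sym (≤[]⇒agreeOn le ¬occ {j} o))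
  ⟦⟧-neg-antimono (∧n neg₁ neg₂) le (x∈₁ , x∈₂) =
    ⟦⟧-neg-antimono neg₁ le x∈₁ , ⟦⟧-neg-antimono neg₂ le x∈₂
  ⟦⟧-neg-antimono (∨n neg₁ neg₂) le (inj₁ x∈) = inj₁ (⟦⟧-neg-antimono neg₁ le x∈)
  ⟦⟧-neg-antimono (∨n neg₁ neg₂) le (inj₂ x∈) = inj₂ (⟦⟧-neg-antimono neg₂ le x∈)
  ⟦⟧-neg-antimono (π₁n neg) le x∈ = ⟦⟧-neg-antimono neg le x∈
  ⟦⟧-neg-antimono (π₂n neg) le x∈ = ⟦⟧-neg-antimono neg le x∈
  ⟦⟧-neg-antimono (in₁n neg) le (x , eq , x∈) = x , eq , ⟦⟧-neg-antimono neg le x∈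
  ⟦⟧-neg-antimono (in₂n neg) le (x , eq , x∈) = x , eq , ⟦⟧-neg-antimono neg le x∈
  ⟦⟧-neg-antimono (foldn neg) le x∈ = ⟦⟧-neg-antimono neg le x∈
  ⟦⟧-neg-antimono (⟹n pos neg) le f∈ x x∈ψ =
    ⟦⟧-neg-antimono neg le (f∈ x (⟦⟧-pos-mono pos le x∈ψ))
  ⟦⟧-neg-antimono (∀n {j = j} neg) le x∈ k = ⟦⟧-neg-antimono neg (≤[]-update j k le) (x∈ k)
  ⟦⟧-neg-antimono {ι₂ = ι₂} (νn {t = t} {φ} neg) le =
    iter-U-⊆ (⟦⟧-body-mono φ ι₂) (λ _ → ⟦⟧-neg-antimono neg le) (evalT-mono t le)
  ⟦⟧-neg-antimono {ι₂ = ι₂} (μn {t = t} {φ} neg ¬occ) le =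
    iter-∅-⊆ (⟦⟧-body-mono φ ι₂) (λ _ → ⟦⟧-neg-antimono neg le)
      (≤-reflexive (sym (evalT-agreeOn t (≤[]⇒agreeOn le ¬occ))))

lemma5p8 : (M : Model) {Θ : Ctx} {τ : CTy} (s : Sign) (φ : Form Θ τ) → WF s φ →
    (ι : IVal) (ρ : Sem.FVal M Θ) (i : ℕ) →
    (Pos i φ → (n m : ℕ) → n ≤ m →
       Sem.⟦_⟧ M φ (ι [ i ↦ n ]) ρ ⊆ Sem.⟦_⟧ M φ (ι [ i ↦ m ]) ρ)
    × (Neg i φ → (n m : ℕ) → m ≤ n →
       Sem.⟦_⟧ M φ (ι [ i ↦ n ]) ρ ⊆ Sem.⟦_⟧ M φ (ι [ i ↦ m ]) ρ)
lemma5p8 M s φ _ ι ρ i =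
    (λ pos n m n≤m → ⟦⟧-pos-mono M pos (update-≤[] ι i n≤m))
  , (λ neg n m m≤n → ⟦⟧-neg-antimono M neg (update-≤[] ι i m≤n))
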